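{- Let $F$ be a recursively enumerable formal system in which infinitely many different theorems can be proved, and let $\mathcal{G}_F$ be as in the context. If $F$ is inconsistent, then $\operatorname{VCdim}(\mathcal{G}_F)=\infty$.
   Context: Let $\mathbb{N}=\{0,1,2,\dots\}$. A formal system $F$ is consistent if no well-formed statement is provable together with its negation, and inconsistent otherwise. Fix a Gödel numbering in which translating statements and forming negations is primitive recursive; theorems are different iff they have different Gödel numbers. $F$ is recursively enumerable if there is a primitive recursive $\varphi:\mathbb{N}\to\mathbb{N}$ whose range is exactly the set of Gödel numbers of statements provable in $F$; fix such $\varphi$. Let $E^2:\mathbb{N}\to\mathbb{N}\times\mathbb{N}$ be a bijection with primitive recursive components $E^2_1,E^2_2$ and primitive recursive inverse. Let $c_c(\{0,1\})$ be the set of finitely supported $a:\mathbb{N}\to\{0,1\}$. For such $a$ let $g_a(n)=a(n)$ if the statement with Gödel number $\varphi(E^2_1(n))$ is the negation of the statement with Gödel number $\varphi(E^2_2(n))$, and $g_a(n)=0$ otherwise; $\mathcal{G}_F=\{g_a: a\in c_c(\{0,1\})\}$. $\operatorname{VCdim}(\mathcal{G})=\sup\{n: \exists S, |S|=n, |\mathcal{G}|_S|=2^n\}$. -}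

module Defs where

open import Data.Nat using (ℕ; zero; suc; _≤_; _≟_)
open import Data.Fin using (Fin)
open import Data.Vec using (Vec; []; _∷_; lookup; map)
open import Data.Bool using (Bool; true; false)
open import Data.Product using (Σ; _×_; _,_; ∃)
open import Function using (_⇔_)
open import Function.Definitions using (Injective)
open import Relation.Binary.PropositionalEquality using (_≡_)
open import Relation.Nullary using (yes; no)

data PR : ℕ → Set where
  pzero : PR 0
  psucc : PR 1
  pproj : ∀ {n} → Fin n → PR n
  pcomp : ∀ {m n} → PR m → Vec (PR n) m → PR n
  prec  : ∀ {n} → PR n → PR (suc (suc n)) → PR (suc n)

mutual
  eval : ∀ {n} → PR n → Vec ℕ n → ℕ
  eval pzero        _        = 0
  eval psucc        (x ∷ []) = suc x
  eval (pproj i)    xs       = lookup xs i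
  eval (pcomp f gs) xs       = eval f (evalAll gs xs)
  eval (prec f g)   (zero  ∷ xs) = eval f xs
  eval (prec f g)   (suc k ∷ xs) = eval g (eval (prec f g) (k ∷ xs) ∷ k ∷ xs)

  evalAll : ∀ {m n} → Vec (PR n) m → Vec ℕ n → Vec ℕ m
  evalAll []       xs = []
  evalAll (g ∷ gs) xs = eval g xs ∷ evalAll gs xs

PrimRec₁ : (ℕ → ℕ) → Set
PrimRec₁ f = Σ (PR 1) λ c → ∀ x → eval c (x ∷ []) ≡ f x

PrimRec₂ : (ℕ → ℕ → ℕ) → Set
PrimRec₂ f = Σ (PR 2) λ c → ∀ x y → eval c (x ∷ y ∷ []) ≡ f x y

-- Formal systems, seen through a fixed Gödel numbering.

record FormalSystem : Set₁ where
  field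
    WF        : ℕ → Set
    Provable  : ℕ → Set
    neg       : ℕ → ℕ
    neg-PR    : PrimRec₁ neg
    neg-WF    : ∀ {s} → WF s → WF (neg s)
    prov-WF   : ∀ {s} → Provable s → WF s
    explosion : ∀ s → Provable s → Provable (neg s) → ∀ t → WF t → Provable t

open FormalSystem public

Consistent : FormalSystem → Set
Consistent F = ∀ s → WF F s → Provable F s → Provable F (neg F s) → Data.Empty.⊥
  where import Data.Empty

Inconsistent : FormalSystem → Set
Inconsistent F = Σ ℕ λ s → WF F s × Provable F s × Provable F (neg F s)

InfinitelyManyTheorems : FormalSystem → Set
InfinitelyManyTheorems F = ∀ m → Σ ℕ λ s → m ≤ s × Provable F s

Enumerates : FormalSystem → (ℕ → ℕ) → Set
Enumerates F φ = PrimRec₁ φ × (∀ s → Provable F s ⇔ ∃ λ i → φ i ≡ s)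

record PairingBijection : Set where
  field
    E₁ E₂   : ℕ → ℕ
    inv     : ℕ → ℕ → ℕ
    E₁-PR   : PrimRec₁ E₁
    E₂-PR   : PrimRec₁ E₂
    inv-PR  : PrimRec₂ inv
    inv-E   : ∀ n → inv (E₁ n) (E₂ n) ≡ n
    E-inv₁  : ∀ x y → E₁ (inv x y) ≡ x
    E-inv₂  : ∀ x y → E₂ (inv x y) ≡ y

open PairingBijection public

-- c_c({0,1}) : finitely supported a : ℕ → {0,1}  ({0,1} represented by Bool)

FinSupp : (ℕ → Bool) → Set
FinSupp a = Σ ℕ λ N → ∀ m → N ≤ m → a m ≡ false

g : (F : FormalSystem) (φ : ℕ → ℕ) (E : PairingBijection) → (ℕ → Bool) → ℕ → Bool
g F φ E a n with φ (E₁ E n) ≟ neg F (φ (E₂ E n))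
... | yes _ = a n
... | no  _ = false

-- VC dimension of a class 𝒢 ⊆ (ℕ → Bool) given by a predicate on
-- index set I.  S of size n = injective Fin n → ℕ.

Shatters : {I : Set} → (I → Set) → (I → ℕ → Bool) → ∀ {n} → (Fin n → ℕ) → Set
Shatters {I} inG G {n} S =
  (b : Fin n → Bool) → Σ I λ a → inG a × (∀ k → G a (S k) ≡ b k)

VCdimInfinite : {I : Set} → (I → Set) → (I → ℕ → Bool) → Set
VCdimInfinite inG G =
  ∀ m → Σ ℕ λ n → m ≤ n × Σ (Fin n → ℕ) λ S → Injective _≡_ _≡_ S × Shatters inG G S

𝒢-VCdimInfinite : FormalSystem → (ℕ → ℕ) → PairingBijection → Set
𝒢-VCdimInfinite F φ E = VCdimInfinite FinSupp (g F φ E)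

-- In an inconsistent system every well-formed statement is provable, in particular the
-- negation ¬t of each of the infinitely many theorems t.  Enumerating t and ¬t by φ gives
-- indices i, j with φ i = ¬(φ j), and the points E²⁻¹(i, j) are pairwise distinct since
-- they recover the distinct theorems t = φ j.  On such "contradictory" points g_a agrees
-- with a, and any labelling of finitely many points extends to a finitely supported a, so
-- every finite set of contradictory points is shattered.
module Submission where

open import Defs
open import Data.Nat using (ℕ; zero; suc; _≤_; _<_; _⊔_; _≟_; s≤s)
open import Data.Nat.Properties
  using (≤-refl; ≤-trans; <-trans; <-irrefl; <-cmp; m≤m⊔n; m≤n⊔m; m≤n⇒m<n∨m≡n)
open import Data.Fin using (Fin; toℕ; zero; suc)
open import Data.Fin.Properties using (toℕ-injective; 0≢1+n; suc-injective)
open import Data.Bool using (Bool; false; if_then_else_)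
open import Data.Product using (Σ; _×_; _,_; proj₁; proj₂)
open import Data.Sum using (inj₁; inj₂)
open import Data.Empty using (⊥-elim)
open import Function using (_∘_)
open import Function.Bundles using (Equivalence)
open import Function.Definitions using (Injective)
open import Relation.Binary using (tri<; tri≈; tri>)
open import Relation.Binary.PropositionalEquality using (_≡_; refl; sym; trans; cong)
open import Relation.Nullary using (does; yes; no)
open import Relation.Nullary.Decidable using (dec-true; dec-false)

extendLabelling : ∀ {n} → (Fin n → ℕ) → (Fin n → Bool) → ℕ → Bool
extendLabelling {zero}  S b x = false
extendLabelling {suc n} S b x =
  if does (S zero ≟ x) then b zero else extendLabelling (S ∘ suc) (b ∘ suc) x

extendLabelling-finSupp : ∀ {n} (S : Fin n → ℕ) b → FinSupp (extendLabelling S b)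
extendLabelling-finSupp {zero}  S b = 0 , λ _ _ → refl
extendLabelling-finSupp {suc n} S b with extendLabelling-finSupp (S ∘ suc) (b ∘ suc)
... | N , vanishes = suc (S zero) ⊔ N , vanishes′
  where
  vanishes′ : ∀ m → suc (S zero) ⊔ N ≤ m → extendLabelling S b m ≡ false
  vanishes′ m le
    rewrite dec-false (S zero ≟ m)
              (λ { refl → <-irrefl refl (≤-trans (m≤m⊔n (suc (S zero)) N) le) })
    = vanishes m (≤-trans (m≤n⊔m (suc (S zero)) N) le)

extendLabelling-agrees : ∀ {n} (S : Fin n → ℕ) b → Injective _≡_ _≡_ S →
                         ∀ k → extendLabelling S b (S k) ≡ b k
extendLabelling-agrees S b S-inj zero rewrite dec-true (S zero ≟ S zero) refl = refl
extendLabelling-agrees S b S-inj (suc k)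
  rewrite dec-false (S zero ≟ S (suc k)) (0≢1+n ∘ S-inj)
  = extendLabelling-agrees (S ∘ suc) (b ∘ suc) (suc-injective ∘ S-inj) k

increasing⇒strictlyMonotone : ∀ (f : ℕ → ℕ) → (∀ k → f k < f (suc k)) →
                              ∀ {i j} → i < j → f i < f j
increasing⇒strictlyMonotone f step {i} {suc j} (s≤s i≤j) with m≤n⇒m<n∨m≡n i≤j
... | inj₁ i<j  = <-trans (increasing⇒strictlyMonotone f step i<j) (step j)
... | inj₂ refl = step j

increasing⇒injective : ∀ (f : ℕ → ℕ) → (∀ k → f k < f (suc k)) → Injective _≡_ _≡_ f
increasing⇒injective f step {i} {j} fi≡fj with <-cmp i j
... | tri< i<j _ _ = ⊥-elim (<-irrefl fi≡fj (increasing⇒strictlyMonotone f step i<j))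
... | tri≈ _ i≡j _ = i≡j
... | tri> _ _ j<i = ⊥-elim (<-irrefl (sym fi≡fj) (increasing⇒strictlyMonotone f step j<i))

unbounded⇒injectiveSequence : (P : ℕ → Set) → (∀ m → Σ ℕ λ s → m ≤ s × P s) →
                              Σ (ℕ → ℕ) λ t → Injective _≡_ _≡_ t × (∀ k → P (t k))
unbounded⇒injectiveSequence P unbounded = t , increasing⇒injective t increasing , satisfies
  where
  t : ℕ → ℕ
  t zero    = proj₁ (unbounded 0)
  t (suc k) = proj₁ (unbounded (suc (t k)))

  increasing : ∀ k → t k < t (suc k)
  increasing k = proj₁ (proj₂ (unbounded (suc (t k))))

  satisfies : ∀ k → P (t k)
  satisfies zero    = proj₂ (proj₂ (unbounded 0))
  satisfies (suc k) = proj₂ (proj₂ (unbounded (suc (t k))))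

inconsistent⇒provable : ∀ F → Inconsistent F → ∀ t → WF F t → Provable F t
inconsistent⇒provable F (s , _ , ⊢s , ⊢¬s) = explosion F s ⊢s ⊢¬s

module _ (F : FormalSystem) (φ : ℕ → ℕ) (E : PairingBijection) where

  Contradictory : ℕ → Set
  Contradictory n = φ (E₁ E n) ≡ neg F (φ (E₂ E n))

  g-contradictory : ∀ a {n} → Contradictory n → g F φ E a n ≡ a n
  g-contradictory a {n} contra with φ (E₁ E n) ≟ neg F (φ (E₂ E n))
  ... | yes _       = refl
  ... | no ¬contra = ⊥-elim (¬contra contra)

  shatters-contradictory : ∀ {n} (S : Fin n → ℕ) → Injective _≡_ _≡_ S →
                           (∀ k → Contradictory (S k)) → Shatters FinSupp (g F φ E) S
  shatters-contradictory S S-inj contra b =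
    extendLabelling S b , extendLabelling-finSupp S b ,
    λ k → trans (g-contradictory (extendLabelling S b) (contra k))
                (extendLabelling-agrees S b S-inj k)

  contradictorySequence⇒VCdimInfinite :
    (p : ℕ → ℕ) → Injective _≡_ _≡_ p → (∀ k → Contradictory (p k)) → 𝒢-VCdimInfinite F φ E
  contradictorySequence⇒VCdimInfinite p p-inj contra m =
    m , ≤-refl , p ∘ toℕ , toℕ-injective ∘ p-inj ,
    shatters-contradictory (p ∘ toℕ) (toℕ-injective ∘ p-inj) (contra ∘ toℕ)

  contradictoryPoint : Enumerates F φ → Inconsistent F → ∀ t → Provable F t →
                       Σ ℕ λ n → Contradictory n × φ (E₂ E n) ≡ t
  contradictoryPoint (_ , enum) inconsistent t ⊢t =
    inv E i j , contradictory , trans (cong φ (E-inv₂ E i j)) φj≡t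
    where
    ⊢¬t : Provable F (neg F t)
    ⊢¬t = inconsistent⇒provable F inconsistent (neg F t) (neg-WF F (prov-WF F ⊢t))
    i j : ℕ
    i = proj₁ (Equivalence.to (enum (neg F t)) ⊢¬t)
    j = proj₁ (Equivalence.to (enum t) ⊢t)
    φi≡¬t : φ i ≡ neg F t
    φi≡¬t = proj₂ (Equivalence.to (enum (neg F t)) ⊢¬t)
    φj≡t : φ j ≡ t
    φj≡t = proj₂ (Equivalence.to (enum t) ⊢t)
    contradictory : Contradictory (inv E i j)
    contradictory rewrite E-inv₁ E i j | E-inv₂ E i j | φi≡¬t | φj≡t = refl

theorem2p7 : (F : FormalSystem) (φ : ℕ → ℕ) (E : PairingBijection) →
    Enumerates F φ → InfinitelyManyTheorems F → Inconsistent F →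
    𝒢-VCdimInfinite F φ E
theorem2p7 F φ E enumerates infinitelyMany inconsistent
  with unbounded⇒injectiveSequence (Provable F) infinitelyMany
... | t , t-inj , ⊢t =
  contradictorySequence⇒VCdimInfinite F φ E p p-inj (proj₁ ∘ proj₂ ∘ point)
  where
  point : ∀ k → Σ ℕ λ n → Contradictory F φ E n × φ (E₂ E n) ≡ t k
  point k = contradictoryPoint F φ E enumerates inconsistent (t k) (⊢t k)

  p : ℕ → ℕ
  p = proj₁ ∘ point

  p-inj : Injective _≡_ _≡_ p
  p-inj {k} {l} pk≡pl = t-inj
    (trans (sym (proj₂ (proj₂ (point k))))
           (trans (cong (φ ∘ E₂ E) pk≡pl) (proj₂ (proj₂ (point l)))))
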